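{- There exists a sequence of real numbers $(\varepsilon_k)_{k\ge 2}$ with $\varepsilon_k\to 0$ as $k\to\infty$ such that for every integer $k\ge 2$ there exist a finite set $Y$ and a union-closed family $\mathcal{F}\subset\mathcal{P}(Y)$ with the following properties: $\mathcal{F}$ has a unique member $S$ of minimum size, $|S|=k$, and every element $x\in S$ has frequency $\gamma_x$ satisfying $$(1-\varepsilon_k)\frac{\log_2 k}{2k}\;\le\;\gamma_x\;\le\;(1+\varepsilon_k)\frac{\log_2 k}{2k}.$$ In other words, each element of the smallest set has frequency $(1+o(1))\frac{\log_2 k}{2k}$.
   Context: A family $\mathcal{F}$ of subsets of a set $Y$ is union-closed if $A\cup B\in\mathcal{F}$ whenever $A,B\in\mathcal{F}$. For a finite nonempty family $\mathcal{F}\subset\mathcal{P}(Y)$ and $x\in Y$, the frequency of $x$ is $\gamma_x=|\{A\in\mathcal{F}: x\in A\}|/|\mathcal{F}|$. The $o(1)$ denotes a quantity tending to $0$ as $k\to\infty$; $\log_2$ is the base-2 logarithm. -}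

module Defs where

open import Data.Nat using (ℕ; _+_; _*_; _^_; _≤_; _<_)
open import Data.Fin using (Fin)
open import Data.Fin.Subset using (Subset; _∪_; ∣_∣) renaming (_∈_ to _∈ₛ_)
open import Data.Fin.Subset.Properties using (_∈?_)
open import Data.List using (List; length; filter)
open import Data.List.Membership.Propositional using (_∈_)
open import Data.List.Relation.Unary.Unique.Propositional using (Unique)
open import Relation.Binary.PropositionalEquality using (_≡_)
open import Relation.Nullary using (¬_)

-- A family of subsets of the finite ground set Y = Fin n, given as a
-- duplicate-free list (so its length is the cardinality |F|).
Family : ℕ → Set
Family n = List (Subset n)

UnionClosed : ∀ {n} → Family n → Set
UnionClosed F = ∀ {A B} → A ∈ F → B ∈ F → (A ∪ B) ∈ F

-- number of members of F containing x  (so γ_x = count x F / length F)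
count : ∀ {n} → Fin n → Family n → ℕ
count x F = length (filter (λ A → x ∈? A) F)

UniqueMinimum : ∀ {n} → Subset n → Family n → Set
UniqueMinimum S F = S ∈ F × (∀ {A} → A ∈ F → ¬ (A ≡ S) → ∣ S ∣ < ∣ A ∣)
  where open import Data.Product using (_×_)

record Construction (k : ℕ) : Set where
  field
    n        : ℕ
    F        : Family n
    distinct : Unique F
    closed   : UnionClosed F
    S        : Subset n
    minimum  : UniqueMinimum S F
    sizeS    : ∣ S ∣ ≡ k

-- With γ = c/m (c = count, m = |F|) and δ = 1/(j+1):
--   γ ≤ (1+δ) log₂ k / (2k)   ⇔   2^(2k(j+1)c) ≤ k^(m(j+2))
--   (1-δ) log₂ k / (2k) ≤ γ   ⇔   k^(m j) ≤ 2^(2k(j+1)c)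
UpperBound : (j k c m : ℕ) → Set
UpperBound j k c m = 2 ^ (2 * k * (j + 1) * c) ≤ k ^ (m * (j + 2))

LowerBound : (j k c m : ℕ) → Set
LowerBound j k c m = k ^ (m * j) ≤ 2 ^ (2 * k * (j + 1) * c)

{-# OPTIONS --safe #-}
-- Let L = ⌊log₂ k⌋ and let R₁, …, R_t list every L-subset of [k], each repeated 2^k times.
-- On the ground set [k] ⊔ {∗} ⊔ [t] take S = [k], the sets a ∪ {∗} ∪ [t] for every a ⊆ [k],
-- and for each p the sets a ∪ {∗} ∪ ([t] ∖ {p}) with a = [k] or a ⊆ R_p.  The marker parts
-- ∅, {∗} ∪ [t] and {∗} ∪ ([t] ∖ {p}) are closed under union, and the admissible parts a over
-- each marker contain [k] and are closed under union (over {∗} ∪ [t] every a is admissible),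
-- so the family is union-closed.  Every member other than S contains at least t > k marker
-- points, so S is the unique smallest member.  A point x ∈ S lies in 1 + 2^(L-1) [x ∈ R_p] of
-- the 1 + 2^L sets over the marker of p, and in an L/k fraction of the R_p; the repetitions
-- make the 2^k sets over {∗} ∪ [t] negligible, so the frequency of x is
-- L/(2k) + O(1/k) = (1 + o(1)) log₂ k / (2k).
module Submission where

open import Defs
open import Data.Bool.Base using (true; false)
open import Data.Empty using (⊥-elim)
open import Data.Fin.Base using (Fin; zero; suc; _↑ˡ_)
import Data.Fin.Properties as Fin
open import Data.Fin.Subset
  using (Subset; Side; inside; outside; _⊆_; _∪_; ∣_∣; ⊤; ⊥; ⁅_⁆; ∁)
  renaming (_∈_ to _∈ₛ_; _∉_ to _∉ₛ_)
open import Data.Fin.Subset.Properties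
  using (_∈?_; drop-there; drop-∷-⊆; s⊆s; out⊆; ⊆⊤; ⊆-antisym; p⊆q⇒∣p∣≤∣q∣; ∈⊤; ∉⊥; ∣⊤∣≡n; ∣⊥∣≡0;
         x∈⁅x⁆; x∈⁅y⁆⇒x≡y; x≢y⇒x∉⁅y⁆; ∣⁅x⁆∣≡1; x∈p⇒x∉∁p; x∉∁p⇒x∈p; x∉p⇒x∈∁p; ∣∁p∣≡n∸∣p∣;
         x∈p∪q⁺; x∈p∪q⁻; ∪-identityˡ; ∪-identityʳ; ∪-zeroˡ; ∪-zeroʳ; ∪-idem)
open import Data.List.Base
  using (List; []; _∷_; [_]; _++_; map; concat; replicate; length; filter; lookup; allFin; tabulate)
open import Data.List.Membership.Propositional using (_∈_)
open import Data.List.Membership.Propositional.Properties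
  using (∈-map⁺; ∈-map⁻; ∈-++⁺ˡ; ∈-++⁺ʳ; ∈-++⁻; ∈-concat⁺′; ∈-concat⁻′; ∈-allFin; ∈-lookup)
import Data.List.Properties as List
open import Data.List.Relation.Unary.All as All using (All; []; _∷_)
import Data.List.Relation.Unary.All.Properties as All
open import Data.List.Relation.Unary.AllPairs as AllPairs using ([]; _∷_)
import Data.List.Relation.Unary.AllPairs.Properties as AllPairs
open import Data.List.Relation.Unary.Any using (here; there)
open import Data.List.Relation.Unary.Unique.Propositional using (Unique)
import Data.List.Relation.Unary.Unique.Propositional.Properties as Unique
open import Data.Nat.Base using (ℕ; zero; suc; _+_; _*_; _^_; _∸_; _≤_; _<_; s≤s; z≤n)
open import Data.Nat.Combinatorics using (_C_; nC1≡n; k>n⇒nCk≡0; nCk+nC[k+1]≡[n+1]C[k+1])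
open import Data.Nat.ListAction using (sum)
open import Data.Nat.Properties
  using (_≟_; module ≤-Reasoning; ≤-refl; ≤-reflexive; ≤-trans; <-irrefl; <⇒≤; <-≤-trans; ≤∧≢⇒<;
         ≮⇒≥; ≤⇒≯; n≤1+n; n<1+n; m≤n⇒m≤1+n; m≤m+n; m≤n+m; m<m+n; m≤n*m;
         +-identityʳ; *-identityˡ; *-identityʳ; *-zeroʳ; *-suc; *-distribˡ-+; *-commutativeSemigroup;
         +-monoˡ-≤; +-monoʳ-≤; +-mono-≤; *-monoˡ-≤; *-monoʳ-≤; *-mono-≤;
         ^-monoˡ-≤; ^-monoʳ-≤; ^-monoʳ-<; ^-*-assoc; m^n>0)
open import Algebra.Properties.CommutativeSemigroup *-commutativeSemigroup using (x∙yz≈y∙xz)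
open import Data.Nat.Solver using (module +-*-Solver)
open import Data.Product.Base using (Σ; ∃; _×_; _,_; proj₁; proj₂)
open import Data.Sum.Base using (inj₁; inj₂)
open import Data.Vec.Base using ([]; _∷_; here; there) renaming (_++_ to _++ᵥ_)
open import Data.Vec.Properties using (∷-injectiveʳ; ++-injectiveˡ; ++-injectiveʳ; zipWith-++)
open import Function.Base using (_∘_)
open import Relation.Nullary.Decidable.Core using (does; yes; no)
open import Relation.Nullary.Negation.Core using (¬_)
open import Relation.Binary.PropositionalEquality
  using (_≡_; _≢_; refl; sym; trans; cong; cong₂; subst; module ≡-Reasoning)

open +-*-Solver

private variable
  n m : ℕ

count-++ : (x : Fin n) (F G : Family n) → count x (F ++ G) ≡ count x F + count x G
count-++ x F G = trans (cong length (List.filter-++ (x ∈?_) F G)) (List.length-++ (filter (x ∈?_) F))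

count-∷-∈ : (x : Fin n) {A : Subset n} (F : Family n) → x ∈ₛ A → count x (A ∷ F) ≡ suc (count x F)
count-∷-∈ x F x∈A = cong length (List.filter-accept (x ∈?_) x∈A)

count-∷-∉ : (x : Fin n) {A : Subset n} (F : Family n) → x ∉ₛ A → count x (A ∷ F) ≡ count x F
count-∷-∉ x F x∉A = cong length (List.filter-reject (x ∈?_) x∉A)

count-map : {x : Fin n} {y : Fin m} (f : Subset m → Subset n) →
            (∀ A → does (x ∈? f A) ≡ does (y ∈? A)) → ∀ F → count x (map f F) ≡ count y F
count-map f eq []      = refl
count-map {y = y} f eq (A ∷ F) rewrite eq A with does (y ∈? A)
... | true  = cong suc (count-map f eq F)
... | false = count-map f eq F

count-zero-inside : (F : Family n) → count zero (map (inside ∷_) F) ≡ length F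
count-zero-inside []      = refl
count-zero-inside (A ∷ F) = cong suc (count-zero-inside F)

count-zero-outside : (F : Family n) → count zero (map (outside ∷_) F) ≡ 0
count-zero-outside []      = refl
count-zero-outside (A ∷ F) = count-zero-outside F

count-suc-∷ : (i : Fin n) (s : Side) (F : Family n) → count (suc i) (map (s ∷_) F) ≡ count i F
count-suc-∷ i s = count-map (s ∷_) (λ _ → refl)

length-concat-replicate : {A : Set} (n : ℕ) (xs : List A) →
                          length (concat (replicate n xs)) ≡ n * length xs
length-concat-replicate zero    xs = refl
length-concat-replicate (suc n) xs =
  trans (List.length-++ xs) (cong (length xs +_) (length-concat-replicate n xs))

count-concat-replicate : (x : Fin m) (n : ℕ) (F : Family m) →
                         count x (concat (replicate n F)) ≡ n * count x F
count-concat-replicate x zero    F = refl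
count-concat-replicate x (suc n) F =
  trans (count-++ x F _) (cong (count x F +_) (count-concat-replicate x n F))

-- Enumerating subsets

branch : Family n → Family n → Family (suc n)
branch F G = map (inside ∷_) F ++ map (outside ∷_) G

length-branch : (F G : Family n) → length (branch F G) ≡ length F + length G
length-branch F G = trans (List.length-++ (map (inside ∷_) F))
  (cong₂ _+_ (List.length-map (inside ∷_) F) (List.length-map (outside ∷_) G))

count-zero-branch : (F G : Family n) → count zero (branch F G) ≡ length F
count-zero-branch F G = trans (count-++ zero (map (inside ∷_) F) _)
  (trans (cong₂ _+_ (count-zero-inside F) (count-zero-outside G)) (+-identityʳ (length F)))

count-suc-branch : (i : Fin n) (F G : Family n) → count (suc i) (branch F G) ≡ count i F + count i G
count-suc-branch i F G = trans (count-++ (suc i) (map (inside ∷_) F) _)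
  (cong₂ _+_ (count-suc-∷ i inside F) (count-suc-∷ i outside G))

branch-unique : {F G : Family n} → Unique F → Unique G → Unique (branch F G)
branch-unique {F = F} {G} F! G! =
  Unique.++⁺ (Unique.map⁺ ∷-injectiveʳ F!) (Unique.map⁺ ∷-injectiveʳ G!) disjoint
  where
  disjoint : ∀ {p} → ¬ (p ∈ map (inside ∷_) F × p ∈ map (outside ∷_) G)
  disjoint (p∈ˡ , p∈ʳ) with ∈-map⁻ (inside ∷_) p∈ˡ | ∈-map⁻ (outside ∷_) p∈ʳ
  ... | _ , _ , refl | _ , _ , ()

subsets : Subset n → Family n
subsets []            = [ [] ]
subsets (outside ∷ r) = branch [] (subsets r)
subsets (inside ∷ r)  = branch (subsets r) (subsets r)

∈-subsets⁺ : {p r : Subset n} → p ⊆ r → p ∈ subsets r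
∈-subsets⁺ {p = []}          {[]}          _   = here refl
∈-subsets⁺ {p = inside ∷ p}  {outside ∷ r} p⊆r with () ← p⊆r here
∈-subsets⁺ {p = outside ∷ p} {outside ∷ r} p⊆r = ∈-map⁺ (outside ∷_) (∈-subsets⁺ (drop-∷-⊆ p⊆r))
∈-subsets⁺ {p = inside ∷ p}  {inside ∷ r}  p⊆r = ∈-++⁺ˡ (∈-map⁺ (inside ∷_) (∈-subsets⁺ (drop-∷-⊆ p⊆r)))
∈-subsets⁺ {p = outside ∷ p} {inside ∷ r}  p⊆r =
  ∈-++⁺ʳ (map (inside ∷_) (subsets r)) (∈-map⁺ (outside ∷_) (∈-subsets⁺ (drop-∷-⊆ p⊆r)))

∈-subsets⁻ : {p : Subset n} (r : Subset n) → p ∈ subsets r → p ⊆ r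
∈-subsets⁻ []            (here refl) ()
∈-subsets⁻ (outside ∷ r) p∈ with ∈-map⁻ (outside ∷_) p∈
... | _ , q∈ , refl = out⊆ (∈-subsets⁻ r q∈)
∈-subsets⁻ (inside ∷ r)  p∈ with ∈-++⁻ (map (inside ∷_) (subsets r)) p∈
... | inj₁ p∈ˡ with _ , q∈ , refl ← ∈-map⁻ (inside ∷_) p∈ˡ = s⊆s (∈-subsets⁻ r q∈)
... | inj₂ p∈ʳ with _ , q∈ , refl ← ∈-map⁻ (outside ∷_) p∈ʳ = out⊆ (∈-subsets⁻ r q∈)

subsets-unionClosed : (r : Subset n) → UnionClosed (subsets r)
subsets-unionClosed r {A} {B} A∈ B∈ = ∈-subsets⁺ A∪B⊆r
  where
  A∪B⊆r : A ∪ B ⊆ r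
  A∪B⊆r x∈ with x∈p∪q⁻ A B x∈
  ... | inj₁ x∈A = ∈-subsets⁻ r A∈ x∈A
  ... | inj₂ x∈B = ∈-subsets⁻ r B∈ x∈B

subsets-unique : (r : Subset n) → Unique (subsets r)
subsets-unique []            = [] ∷ []
subsets-unique (outside ∷ r) = branch-unique [] (subsets-unique r)
subsets-unique (inside ∷ r)  = branch-unique (subsets-unique r) (subsets-unique r)

2^[1+n]≡2^n+2^n : ∀ n → 2 ^ suc n ≡ 2 ^ n + 2 ^ n
2^[1+n]≡2^n+2^n n = cong (2 ^ n +_) (+-identityʳ (2 ^ n))

length-subsets : (r : Subset n) → length (subsets r) ≡ 2 ^ ∣ r ∣
length-subsets []            = refl
length-subsets (outside ∷ r) = trans (length-branch [] (subsets r)) (length-subsets r)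
length-subsets (inside ∷ r)  = begin
  length (branch (subsets r) (subsets r))  ≡⟨ length-branch (subsets r) (subsets r) ⟩
  length (subsets r) + length (subsets r)  ≡⟨ cong (λ l → l + l) (length-subsets r) ⟩
  2 ^ ∣ r ∣ + 2 ^ ∣ r ∣                    ≡⟨ 2^[1+n]≡2^n+2^n ∣ r ∣ ⟨
  2 ^ suc ∣ r ∣                            ∎
  where open ≡-Reasoning

count-subsets-∈ : {i : Fin n} (r : Subset n) → i ∈ₛ r → 2 * count i (subsets r) ≡ 2 ^ ∣ r ∣
count-subsets-∈ {i = zero} (inside ∷ r) here =
  cong (2 *_) (trans (count-zero-branch (subsets r) (subsets r)) (length-subsets r))
count-subsets-∈ {i = suc i} (outside ∷ r) (there i∈r) =
  trans (cong (2 *_) (count-suc-branch i [] (subsets r))) (count-subsets-∈ r i∈r)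
count-subsets-∈ {i = suc i} (inside ∷ r) (there i∈r) = begin
  2 * count (suc i) (branch (subsets r) (subsets r))
    ≡⟨ cong (2 *_) (count-suc-branch i (subsets r) (subsets r)) ⟩
  2 * (count i (subsets r) + count i (subsets r))
    ≡⟨ *-distribˡ-+ 2 (count i (subsets r)) _ ⟩
  2 * count i (subsets r) + 2 * count i (subsets r)
    ≡⟨ cong (λ c → c + c) (count-subsets-∈ r i∈r) ⟩
  2 ^ ∣ r ∣ + 2 ^ ∣ r ∣
    ≡⟨ 2^[1+n]≡2^n+2^n ∣ r ∣ ⟨
  2 ^ suc ∣ r ∣ ∎
  where open ≡-Reasoning

count-subsets-∉ : {i : Fin n} (r : Subset n) → i ∉ₛ r → count i (subsets r) ≡ 0
count-subsets-∉ {i = zero}  (inside ∷ r)  i∉r = ⊥-elim (i∉r here)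
count-subsets-∉ {i = zero}  (outside ∷ r) _   = count-zero-branch [] (subsets r)
count-subsets-∉ {i = suc i} (outside ∷ r) i∉r =
  trans (count-suc-branch i [] (subsets r)) (count-subsets-∉ r (i∉r ∘ there))
count-subsets-∉ {i = suc i} (inside ∷ r)  i∉r =
  trans (count-suc-branch i (subsets r) (subsets r)) (cong (λ c → c + c) (count-subsets-∉ r (i∉r ∘ there)))

subsetsOfSize : (n k : ℕ) → Family n
subsetsOfSize n       zero    = [ ⊥ ]
subsetsOfSize zero    (suc k) = []
subsetsOfSize (suc n) (suc k) = branch (subsetsOfSize n k) (subsetsOfSize n (suc k))

∣∣-subsetsOfSize : ∀ n k → All (λ p → ∣ p ∣ ≡ k) (subsetsOfSize n k)
∣∣-subsetsOfSize n       zero    = ∣⊥∣≡0 n ∷ []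
∣∣-subsetsOfSize zero    (suc k) = []
∣∣-subsetsOfSize (suc n) (suc k) =
  All.++⁺ (All.map⁺ (All.map (cong suc) (∣∣-subsetsOfSize n k))) (All.map⁺ (∣∣-subsetsOfSize n (suc k)))

length-subsetsOfSize : ∀ n k → length (subsetsOfSize n k) ≡ n C k
length-subsetsOfSize n       zero    = refl
length-subsetsOfSize zero    (suc k) = refl
length-subsetsOfSize (suc n) (suc k) = begin
  length (subsetsOfSize (suc n) (suc k))
    ≡⟨ length-branch (subsetsOfSize n k) (subsetsOfSize n (suc k)) ⟩
  length (subsetsOfSize n k) + length (subsetsOfSize n (suc k))
    ≡⟨ cong₂ _+_ (length-subsetsOfSize n k) (length-subsetsOfSize n (suc k)) ⟩
  n C k + n C suc k
    ≡⟨ nCk+nC[k+1]≡[n+1]C[k+1] n k ⟩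
  suc n C suc k ∎
  where open ≡-Reasoning

length-subsetsOfSize>0 : ∀ {n k} → k ≤ n → 0 < length (subsetsOfSize n k)
length-subsetsOfSize>0 {n}     {zero}  _         = s≤s z≤n
length-subsetsOfSize>0 {suc n} {suc k} (s≤s k≤n) = begin-strict
  0                                                             <⟨ length-subsetsOfSize>0 k≤n ⟩
  length (subsetsOfSize n k)                                    ≤⟨ m≤m+n _ _ ⟩
  length (subsetsOfSize n k) + length (subsetsOfSize n (suc k)) ≡⟨ length-branch (subsetsOfSize n k) _ ⟨
  length (subsetsOfSize (suc n) (suc k))                        ∎
  where open ≤-Reasoning

count-subsetsOfSize : ∀ n k (i : Fin (suc n)) → count i (subsetsOfSize (suc n) (suc k)) ≡ n C k
count-subsetsOfSize n k zero =
  trans (count-zero-branch (subsetsOfSize n k) _) (length-subsetsOfSize n k)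
count-subsetsOfSize (suc n) k (suc i) =
  trans (count-suc-branch i (subsetsOfSize (suc n) k) (subsetsOfSize (suc n) (suc k))) (pascal k)
  where
  pascal : ∀ k → count i (subsetsOfSize (suc n) k) + count i (subsetsOfSize (suc n) (suc k)) ≡ suc n C k
  pascal zero    = cong₂ _+_ (count-∷-∉ i [] ∉⊥) (count-subsetsOfSize n zero i)
  pascal (suc k) = trans (cong₂ _+_ (count-subsetsOfSize n k i) (count-subsetsOfSize n (suc k) i))
                         (nCk+nC[k+1]≡[n+1]C[k+1] n k)

[n+1]*nCk≡[k+1]*[n+1]C[k+1] : ∀ n k → suc n * (n C k) ≡ suc k * (suc n C suc k)
[n+1]*nCk≡[k+1]*[n+1]C[k+1] zero    zero    = refl
[n+1]*nCk≡[k+1]*[n+1]C[k+1] zero    (suc k) =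
  sym (trans (cong ((2 + k) *_) (k>n⇒nCk≡0 (s≤s (s≤s (z≤n {k}))))) (*-zeroʳ (2 + k)))
[n+1]*nCk≡[k+1]*[n+1]C[k+1] (suc n) zero    =
  trans (*-identityʳ (2 + n)) (sym (trans (*-identityˡ _) (nC1≡n (2 + n))))
[n+1]*nCk≡[k+1]*[n+1]C[k+1] (suc n) (suc k) = begin
  (2 + n) * X                    ≡⟨ solve 2 (λ n X → (con 2 :+ n) :* X := (con 1 :+ n) :* X :+ X) refl n X ⟩
  (1 + n) * X + X                ≡⟨ cong (λ x → (1 + n) * x + X) (nCk+nC[k+1]≡[n+1]C[k+1] n k) ⟨
  (1 + n) * (a + b) + X          ≡⟨ cong (_+ X) (*-distribˡ-+ (1 + n) a b) ⟩
  (1 + n) * a + (1 + n) * b + X  ≡⟨ cong₂ (λ u v → u + v + X) ([n+1]*nCk≡[k+1]*[n+1]C[k+1] n k)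
                                                             ([n+1]*nCk≡[k+1]*[n+1]C[k+1] n (suc k)) ⟩
  (1 + k) * X + (2 + k) * Y + X  ≡⟨ solve 3 (λ k X Y → (con 1 :+ k) :* X :+ (con 2 :+ k) :* Y :+ X
                                                       := (con 2 :+ k) :* (X :+ Y)) refl k X Y ⟩
  (2 + k) * (X + Y)              ≡⟨ cong ((2 + k) *_) (nCk+nC[k+1]≡[n+1]C[k+1] (suc n) (suc k)) ⟩
  (2 + k) * ((2 + n) C (2 + k))  ∎
  where
  open ≡-Reasoning
  a = n C k
  b = n C suc k
  X = suc n C suc k
  Y = suc n C suc (suc k)

subsetsOfSize-regular : ∀ n k (i : Fin n) → n * count i (subsetsOfSize n k) ≡ k * length (subsetsOfSize n k)
subsetsOfSize-regular (suc n) zero    i = trans (cong (suc n *_) (count-∷-∉ i [] ∉⊥)) (*-zeroʳ (suc n))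
subsetsOfSize-regular (suc n) (suc k) i = begin
  suc n * count i (subsetsOfSize (suc n) (suc k)) ≡⟨ cong (suc n *_) (count-subsetsOfSize n k i) ⟩
  suc n * (n C k)                                 ≡⟨ [n+1]*nCk≡[k+1]*[n+1]C[k+1] n k ⟩
  suc k * (suc n C suc k)                         ≡⟨ cong (suc k *_) (length-subsetsOfSize (suc n) (suc k)) ⟨
  suc k * length (subsetsOfSize (suc n) (suc k))  ∎
  where open ≡-Reasoning

∁⁅x⁆∪∁⁅y⁆≡⊤ : {x y : Fin n} → x ≢ y → ∁ ⁅ x ⁆ ∪ ∁ ⁅ y ⁆ ≡ ⊤
∁⁅x⁆∪∁⁅y⁆≡⊤ {x = x} {y} x≢y = ⊆-antisym ⊆⊤ ⊤⊆
  where
  ⊤⊆ : ⊤ ⊆ ∁ ⁅ x ⁆ ∪ ∁ ⁅ y ⁆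
  ⊤⊆ {z} _ with z Fin.≟ x
  ... | yes refl = x∈p∪q⁺ (inj₂ (x∉p⇒x∈∁p (x≢y⇒x∉⁅y⁆ x≢y)))
  ... | no z≢x   = x∈p∪q⁺ (inj₁ (x∉p⇒x∈∁p (x≢y⇒x∉⁅y⁆ z≢x)))

∁⁅x⁆≢⊤ : (x : Fin n) → ∁ ⁅ x ⁆ ≢ ⊤
∁⁅x⁆≢⊤ x eq = x∈p⇒x∉∁p (x∈⁅x⁆ x) (subst (x ∈ₛ_) (sym eq) ∈⊤)

∁⁅⁆-injective : {x y : Fin n} → ∁ ⁅ x ⁆ ≡ ∁ ⁅ y ⁆ → x ≡ y
∁⁅⁆-injective {x = x} {y} eq =
  x∈⁅y⁆⇒x≡y y (x∉∁p⇒x∈p (subst (x ∉ₛ_) eq (x∈p⇒x∉∁p (x∈⁅x⁆ x))))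

∣∁⁅x⁆∣≡n∸1 : (x : Fin n) → ∣ ∁ ⁅ x ⁆ ∣ ≡ n ∸ 1
∣∁⁅x⁆∣≡n∸1 x = trans (∣∁p∣≡n∸∣p∣ ⁅ x ⁆) (cong (_ ∸_) (∣⁅x⁆∣≡1 x))

∣∣-++ : ∀ {k m} (a : Subset k) (b : Subset m) → ∣ a ++ᵥ b ∣ ≡ ∣ a ∣ + ∣ b ∣
∣∣-++ []            b = refl
∣∣-++ (inside ∷ a)  b = cong suc (∣∣-++ a b)
∣∣-++ (outside ∷ a) b = ∣∣-++ a b

⊤∷subsets-unionClosed : (r : Subset n) → UnionClosed (⊤ ∷ subsets r)
⊤∷subsets-unionClosed r (here refl) (here refl) = here (∪-idem ⊤)
⊤∷subsets-unionClosed r (here refl) (there _)   = here (∪-zeroˡ _)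
⊤∷subsets-unionClosed r (there _)   (here refl) = here (∪-zeroʳ _)
⊤∷subsets-unionClosed r (there A∈)  (there B∈)  = there (subsets-unionClosed r A∈ B∈)

does-↑ˡ-∈?-++ : ∀ {k m} (a : Subset k) (b : Subset m) (i : Fin k) →
                does (i ↑ˡ m ∈? a ++ᵥ b) ≡ does (i ∈? a)
does-↑ˡ-∈?-++ (inside ∷ a)  b zero    = refl
does-↑ˡ-∈?-++ (outside ∷ a) b zero    = refl
does-↑ˡ-∈?-++ (s ∷ a)       b (suc i) = does-↑ˡ-∈?-++ a b i

∈-++⊥⇒↑ˡ : ∀ {k m} (a : Subset k) {x : Fin (k + m)} → x ∈ₛ a ++ᵥ ⊥ → ∃ λ i → x ≡ i ↑ˡ m
∈-++⊥⇒↑ˡ []      x∈          = ⊥-elim (∉⊥ x∈)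
∈-++⊥⇒↑ˡ (s ∷ a) {zero}  _   = zero , refl
∈-++⊥⇒↑ˡ (s ∷ a) {suc x} x∈ with i , refl ← ∈-++⊥⇒↑ˡ a (drop-there x∈) = suc i , refl

map-∘-lookup-allFin : {A B : Set} (f : A → B) (xs : List A) →
                      map (f ∘ lookup xs) (allFin (length xs)) ≡ map f xs
map-∘-lookup-allFin f xs = begin
  map (f ∘ lookup xs) (allFin (length xs)) ≡⟨ List.map-tabulate (λ p → p) (f ∘ lookup xs) ⟩
  tabulate (f ∘ lookup xs)                ≡⟨ List.map-tabulate (lookup xs) f ⟨
  map f (tabulate (lookup xs))            ≡⟨ cong (map f) (List.tabulate-lookup xs) ⟩
  map f xs                                ∎
  where open ≡-Reasoning

sum-length-⊤∷subsets : ∀ {L} {Rs : List (Subset n)} → All (λ R → ∣ R ∣ ≡ L) Rs →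
                       sum (map (λ R → length (⊤ ∷ subsets R)) Rs) ≡ length Rs * (1 + 2 ^ L)
sum-length-⊤∷subsets []                    = refl
sum-length-⊤∷subsets {Rs = R ∷ Rs} (refl ∷ uniform) =
  cong₂ (λ l s → suc l + s) (length-subsets R) (sum-length-⊤∷subsets uniform)

-- count i [ R ] is the indicator of i ∈ R.
2*count-subsets : (i : Fin n) (R : Subset n) → 2 * count i (subsets R) ≡ 2 ^ ∣ R ∣ * count i [ R ]
2*count-subsets i R with i ∈? R
... | yes i∈R = trans (count-subsets-∈ R i∈R) (sym (*-identityʳ (2 ^ ∣ R ∣)))
... | no  i∉R = trans (cong (2 *_) (count-subsets-∉ R i∉R)) (sym (*-zeroʳ (2 ^ ∣ R ∣)))

2*sum-count-⊤∷subsets : ∀ {L} (i : Fin n) {Rs : List (Subset n)} → All (λ R → ∣ R ∣ ≡ L) Rs →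
  2 * sum (map (λ R → count i (⊤ ∷ subsets R)) Rs) ≡ 2 * length Rs + 2 ^ L * count i Rs
2*sum-count-⊤∷subsets {L = L} i []                         = cong (0 +_) (sym (*-zeroʳ (2 ^ L)))
2*sum-count-⊤∷subsets {L = L} i {R ∷ Rs} (refl ∷ uniform) = begin
  2 * (count i (⊤ ∷ subsets R) + s)      ≡⟨ cong (λ c → 2 * (c + s)) (count-∷-∈ i (subsets R) ∈⊤) ⟩
  2 * (suc c + s)                        ≡⟨ solve 2 (λ c s → con 2 :* (con 1 :+ c :+ s)
                                                       := con 2 :+ con 2 :* c :+ con 2 :* s) refl c s ⟩
  2 + 2 * c + 2 * s                      ≡⟨ cong₂ (λ u v → 2 + u + v) (2*count-subsets i R)
                                                                      (2*sum-count-⊤∷subsets i uniform) ⟩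
  2 + P * e + (2 * length Rs + P * r)    ≡⟨ solve 4 (λ P e l r → con 2 :+ P :* e :+ (con 2 :* l :+ P :* r)
                                                       := con 2 :* (con 1 :+ l) :+ P :* (e :+ r))
                                                   refl P e (length Rs) r ⟩
  2 * suc (length Rs) + P * (e + r)      ≡⟨ cong (λ r → 2 * suc (length Rs) + P * r) (count-++ i [ R ] Rs) ⟨
  2 * suc (length Rs) + P * count i (R ∷ Rs) ∎
  where
  open ≡-Reasoning
  P = 2 ^ L
  c = count i (subsets R)
  s = sum (map (λ R → count i (⊤ ∷ subsets R)) Rs)
  e = count i [ R ]
  r = count i Rs

-- Gluing families along markers

module Gluing {k m : ℕ} {Tag : Set} (marker : Tag → Subset m) (fibre : Tag → Family k) where

  layer : Tag → Family (k + m)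
  layer τ = map (_++ᵥ marker τ) (fibre τ)

  glue : List Tag → Family (k + m)
  glue τs = concat (map layer τs)

  ∈-glue⁺ : ∀ {τs τ a} → τ ∈ τs → a ∈ fibre τ → a ++ᵥ marker τ ∈ glue τs
  ∈-glue⁺ τ∈ a∈ = ∈-concat⁺′ (∈-map⁺ (_++ᵥ marker _) a∈) (∈-map⁺ layer τ∈)

  ∈-glue⁻ : ∀ τs {A} → A ∈ glue τs → ∃ λ τ → ∃ λ a → τ ∈ τs × a ∈ fibre τ × A ≡ a ++ᵥ marker τ
  ∈-glue⁻ τs A∈ with ∈-concat⁻′ (map layer τs) A∈
  ... | _ , A∈layer , layer∈ with ∈-map⁻ layer layer∈
  ...   | τ , τ∈ , refl with ∈-map⁻ (_++ᵥ marker τ) A∈layer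
  ...     | a , a∈ , A≡ = τ , a , τ∈ , a∈ , A≡

  glue-unionClosed : ∀ τs (_⊔_ : Tag → Tag → Tag) →
    (∀ {τ σ} → τ ∈ τs → σ ∈ τs → τ ⊔ σ ∈ τs) →
    (∀ τ σ → marker τ ∪ marker σ ≡ marker (τ ⊔ σ)) →
    (∀ τ σ {a b} → a ∈ fibre τ → b ∈ fibre σ → a ∪ b ∈ fibre (τ ⊔ σ)) →
    UnionClosed (glue τs)
  glue-unionClosed τs _⊔_ ⊔-closed marker-⊔ fibre-∪ A∈ B∈
    with τ , a , τ∈ , a∈ , refl ← ∈-glue⁻ τs A∈
       | σ , b , σ∈ , b∈ , refl ← ∈-glue⁻ τs B∈ =
    subst (_∈ glue τs) A∪B≡ (∈-glue⁺ (⊔-closed τ∈ σ∈) (fibre-∪ τ σ a∈ b∈))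
    where
    A∪B≡ : (a ∪ b) ++ᵥ marker (τ ⊔ σ) ≡ (a ++ᵥ marker τ) ∪ (b ++ᵥ marker σ)
    A∪B≡ = sym (trans (zipWith-++ _ a (marker τ) b (marker σ)) (cong ((a ∪ b) ++ᵥ_) (marker-⊔ τ σ)))

  glue-unique : ∀ {τs} → Unique τs → (∀ {τ σ} → marker τ ≡ marker σ → τ ≡ σ) →
                (∀ τ → Unique (fibre τ)) → Unique (glue τs)
  glue-unique {τs} τs! marker-injective fibre! =
    Unique.concat⁺ (All.map⁺ (All.universal layer! τs)) (AllPairs.map⁺ (AllPairs.map disjoint τs!))
    where
    layer! : ∀ τ → Unique (layer τ)
    layer! τ = Unique.map⁺ (λ {a} {b} → ++-injectiveˡ a b) (fibre! τ)
    disjoint : ∀ {τ σ} → τ ≢ σ → ∀ {A} → ¬ (A ∈ layer τ × A ∈ layer σ)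
    disjoint τ≢σ (A∈τ , A∈σ) with a , _ , refl ← ∈-map⁻ _ A∈τ | b , _ , eq ← ∈-map⁻ _ A∈σ =
      τ≢σ (marker-injective (++-injectiveʳ a b eq))

  count-glue : ∀ τs (i : Fin k) → count (i ↑ˡ m) (glue τs) ≡ sum (map (count i ∘ fibre) τs)
  count-glue []       i = refl
  count-glue (τ ∷ τs) i = trans (count-++ (i ↑ˡ m) (layer τ) (glue τs)) (cong₂ _+_
    (count-map (_++ᵥ marker τ) (λ a → does-↑ˡ-∈?-++ a (marker τ) i) (fibre τ)) (count-glue τs i))

  length-glue : ∀ τs → length (glue τs) ≡ sum (map (length ∘ fibre) τs)
  length-glue []       = refl
  length-glue (τ ∷ τs) = trans (List.length-++ (layer τ))
    (cong₂ _+_ (List.length-map (_++ᵥ marker τ) (fibre τ)) (length-glue τs))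

-- A marker is a subset of {∗} ⊔ [t] = Fin (suc t), with ∗ the point zero.
data Tag (t : ℕ) : Set where
  base full : Tag t
  punctured : Fin t → Tag t

module _ {t : ℕ} where

  marker : Tag t → Subset (suc t)
  marker base          = ⊥
  marker full          = ⊤
  marker (punctured p) = ∁ ⁅ suc p ⁆

  _⊔_ : Tag t → Tag t → Tag t
  base        ⊔ σ            = σ
  full        ⊔ σ            = full
  punctured p ⊔ base         = punctured p
  punctured p ⊔ full         = full
  punctured p ⊔ punctured q with p Fin.≟ q
  ... | yes _ = punctured p
  ... | no  _ = full

  marker-⊔ : ∀ τ σ → marker τ ∪ marker σ ≡ marker (τ ⊔ σ)
  marker-⊔ base          σ    = ∪-identityˡ (marker σ)
  marker-⊔ full          σ    = ∪-zeroˡ (marker σ)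
  marker-⊔ (punctured p) base = ∪-identityʳ (marker (punctured p))
  marker-⊔ (punctured p) full = ∪-zeroʳ (marker (punctured p))
  marker-⊔ (punctured p) (punctured q) with p Fin.≟ q
  ... | yes refl = ∪-idem (marker (punctured p))
  ... | no  p≢q  = ∁⁅x⁆∪∁⁅y⁆≡⊤ (p≢q ∘ Fin.suc-injective)

  marker-injective : ∀ {τ σ} → marker τ ≡ marker σ → τ ≡ σ
  marker-injective {base}        {base}        _  = refl
  marker-injective {full}        {full}        _  = refl
  marker-injective {full}        {punctured q} eq = ⊥-elim (∁⁅x⁆≢⊤ (suc q) (sym eq))
  marker-injective {punctured p} {full}        eq = ⊥-elim (∁⁅x⁆≢⊤ (suc p) eq)
  marker-injective {punctured p} {punctured q} eq = cong punctured (Fin.suc-injective (∁⁅⁆-injective eq))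

  t≤∣marker∣ : ∀ τ → τ ≢ base → t ≤ ∣ marker τ ∣
  t≤∣marker∣ base          τ≢base = ⊥-elim (τ≢base refl)
  t≤∣marker∣ full          _      = ≤-trans (n≤1+n t) (≤-reflexive (sym (∣⊤∣≡n (suc t))))
  t≤∣marker∣ (punctured p) _      = ≤-reflexive (sym (∣∁⁅x⁆∣≡n∸1 (suc p)))

  tags : List (Tag t)
  tags = base ∷ full ∷ map punctured (allFin t)

  ∈-tags : ∀ τ → τ ∈ tags
  ∈-tags base          = here refl
  ∈-tags full          = there (here refl)
  ∈-tags (punctured p) = there (there (∈-map⁺ punctured (∈-allFin p)))

  tags-unique : Unique tags
  tags-unique = ((λ ()) ∷ All.map⁺ (All.universal (λ _ ()) _))
              ∷ All.map⁺ (All.universal (λ _ ()) _)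
              ∷ Unique.map⁺ punctured-injective (Unique.allFin⁺ t)
    where
    punctured-injective : ∀ {p q} → punctured p ≡ punctured q → p ≡ q
    punctured-injective refl = refl

module UniformConstruction {k L : ℕ} (Rs : List (Subset k)) (uniform : All (λ R → ∣ R ∣ ≡ L) Rs)
                           (L<k : L < k) (k<t : k < length Rs) where

  t : ℕ
  t = length Rs

  fibre : Tag t → Family k
  fibre base          = [ ⊤ ]
  fibre full          = subsets ⊤
  fibre (punctured p) = ⊤ ∷ subsets (lookup Rs p)

  ⊤∈fibre : ∀ τ → ⊤ ∈ fibre τ
  ⊤∈fibre base          = here refl
  ⊤∈fibre full          = ∈-subsets⁺ ⊆⊤
  ⊤∈fibre (punctured p) = here refl

  fibre-∪ : ∀ τ σ {a b} → a ∈ fibre τ → b ∈ fibre σ → a ∪ b ∈ fibre (τ ⊔ σ)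
  fibre-∪ base          σ             (here refl) _           = subst (_∈ fibre σ) (sym (∪-zeroˡ _)) (⊤∈fibre σ)
  fibre-∪ full          σ             _           _           = ∈-subsets⁺ ⊆⊤
  fibre-∪ (punctured p) base          _           (here refl) = here (∪-zeroʳ _)
  fibre-∪ (punctured p) full          _           _           = ∈-subsets⁺ ⊆⊤
  fibre-∪ (punctured p) (punctured q) a∈          b∈ with p Fin.≟ q
  ... | yes refl = ⊤∷subsets-unionClosed (lookup Rs p) a∈ b∈
  ... | no  _    = ∈-subsets⁺ ⊆⊤

  fibre-unique : ∀ τ → Unique (fibre τ)
  fibre-unique base          = [] ∷ []
  fibre-unique full          = subsets-unique ⊤
  fibre-unique (punctured p) = All.tabulate ⊤∉subsets ∷ subsets-unique (lookup Rs p)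
    where
    ⊤∉subsets : ∀ {a} → a ∈ subsets (lookup Rs p) → ⊤ ≢ a
    ⊤∉subsets {a} a∈ refl = <-irrefl (∣⊤∣≡n k) (begin-strict
      ∣ ⊤ {k} ∣           ≤⟨ p⊆q⇒∣p∣≤∣q∣ (∈-subsets⁻ (lookup Rs p) a∈) ⟩
      ∣ lookup Rs p ∣     ≡⟨ All.lookup uniform (∈-lookup p) ⟩
      L                   <⟨ L<k ⟩
      k                   ∎)
      where open ≤-Reasoning

  open Gluing marker fibre

  S : Subset (k + suc t)
  S = ⊤ {k} ++ᵥ ⊥ {suc t}

  F : Family (k + suc t)
  F = glue tags

  ∣S∣≡k : ∣ S ∣ ≡ k
  ∣S∣≡k = trans (∣∣-++ (⊤ {k}) ⊥) (trans (cong₂ _+_ (∣⊤∣≡n k) (∣⊥∣≡0 (suc t))) (+-identityʳ k))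

  ∣S∣<∣a++marker∣ : ∀ τ (a : Subset k) → τ ≢ base → ∣ S ∣ < ∣ a ++ᵥ marker τ ∣
  ∣S∣<∣a++marker∣ τ a τ≢base = begin-strict
    ∣ S ∣                    ≡⟨ ∣S∣≡k ⟩
    k                        <⟨ k<t ⟩
    t                        ≤⟨ t≤∣marker∣ τ τ≢base ⟩
    ∣ marker τ ∣             ≤⟨ m≤n+m _ ∣ a ∣ ⟩
    ∣ a ∣ + ∣ marker τ ∣     ≡⟨ ∣∣-++ a (marker τ) ⟨
    ∣ a ++ᵥ marker τ ∣       ∎
    where open ≤-Reasoning

  S-uniqueMinimum : UniqueMinimum S F
  S-uniqueMinimum = here refl , smaller
    where
    smaller : ∀ {A} → A ∈ F → A ≢ S → ∣ S ∣ < ∣ A ∣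
    smaller A∈ A≢S with ∈-glue⁻ tags A∈
    ... | base        , _ , _ , here refl , refl = ⊥-elim (A≢S refl)
    ... | full        , a , _ , _         , refl = ∣S∣<∣a++marker∣ full a (λ ())
    ... | punctured p , a , _ , _         , refl = ∣S∣<∣a++marker∣ (punctured p) a (λ ())

  construction : Construction k
  construction = record
    { n        = k + suc t
    ; F        = F
    ; distinct = glue-unique tags-unique marker-injective fibre-unique
    ; closed   = glue-unionClosed tags _⊔_ (λ {τ} {σ} _ _ → ∈-tags (τ ⊔ σ)) marker-⊔ fibre-∪
    ; S        = S
    ; minimum  = S-uniqueMinimum
    ; sizeS    = ∣S∣≡k
    }

  sum-tags : (g : Tag t → ℕ) (h : Subset k → ℕ) → (∀ p → g (punctured p) ≡ h (lookup Rs p)) →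
             sum (map g tags) ≡ g base + (g full + sum (map h Rs))
  sum-tags g h g≗h = cong (λ s → g base + (g full + sum s)) (begin
    map g (map punctured (allFin t)) ≡⟨ List.map-∘ (allFin t) ⟨
    map (g ∘ punctured) (allFin t)   ≡⟨ List.map-cong g≗h (allFin t) ⟩
    map (h ∘ lookup Rs) (allFin t)   ≡⟨ map-∘-lookup-allFin h Rs ⟩
    map h Rs                         ∎)
    where open ≡-Reasoning

  length-F : length F ≡ 1 + (2 ^ k + t * (1 + 2 ^ L))
  length-F = begin
    length F                                             ≡⟨ length-glue tags ⟩
    sum (map (length ∘ fibre) tags)                      ≡⟨ sum-tags (length ∘ fibre) l (λ _ → refl) ⟩
    1 + (length (subsets (⊤ {k})) + sum (map l Rs))      ≡⟨ cong₂ (λ a b → 1 + (a + b)) length-subsets-⊤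
                                                                                   (sum-length-⊤∷subsets uniform) ⟩
    1 + (2 ^ k + t * (1 + 2 ^ L))                        ∎
    where
    open ≡-Reasoning
    l : Subset k → ℕ
    l R = length (⊤ ∷ subsets R)
    length-subsets-⊤ : length (subsets (⊤ {k})) ≡ 2 ^ k
    length-subsets-⊤ = trans (length-subsets (⊤ {k})) (cong (2 ^_) (∣⊤∣≡n k))

  2*count-F : (i : Fin k) → 2 * count (i ↑ˡ suc t) F ≡ 2 + 2 ^ k + (2 * t + 2 ^ L * count i Rs)
  2*count-F i = begin
    2 * count (i ↑ˡ suc t) F                  ≡⟨ cong (2 *_) (count-glue tags i) ⟩
    2 * sum (map (count i ∘ fibre) tags)      ≡⟨ cong (2 *_) (sum-tags (count i ∘ fibre) c (λ _ → refl)) ⟩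
    2 * (count i [ ⊤ ] + (c⊤ + sum (map c Rs))) ≡⟨ cong (λ x → 2 * (x + (c⊤ + sum (map c Rs)))) (count-∷-∈ i [] ∈⊤) ⟩
    2 * (1 + (c⊤ + sum (map c Rs)))           ≡⟨ solve 2 (λ a b → con 2 :* (con 1 :+ (a :+ b))
                                                          := con 2 :+ con 2 :* a :+ con 2 :* b) refl c⊤ (sum (map c Rs)) ⟩
    2 + 2 * c⊤ + 2 * sum (map c Rs)           ≡⟨ cong₂ (λ a b → 2 + a + b) 2*c⊤≡2^k (2*sum-count-⊤∷subsets i uniform) ⟩
    2 + 2 ^ k + (2 * t + 2 ^ L * count i Rs)  ∎
    where
    open ≡-Reasoning
    c : Subset k → ℕ
    c R = count i (⊤ ∷ subsets R)
    c⊤ : ℕ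
    c⊤ = count i (subsets (⊤ {k}))
    2*c⊤≡2^k : 2 * c⊤ ≡ 2 ^ k
    2*c⊤≡2^k = trans (count-subsets-∈ (⊤ {k}) ∈⊤) (cong (2 ^_) (∣⊤∣≡n k))

-- The frequency bounds

n<2^n : ∀ n → n < 2 ^ n
n<2^n zero    = s≤s z≤n
n<2^n (suc n) = begin-strict
  suc n         ≤⟨ n<2^n n ⟩
  2 ^ n         <⟨ m<m+n (2 ^ n) (m^n>0 2 n) ⟩
  2 ^ n + 2 ^ n ≡⟨ 2^[1+n]≡2^n+2^n n ⟨
  2 ^ suc n     ∎
  where open ≤-Reasoning

floor-log₂ : ∀ k → ∃ λ L → 2 ^ L ≤ suc k × suc k < 2 ^ suc L
floor-log₂ zero    = 0 , ≤-refl , s≤s (s≤s z≤n)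
floor-log₂ (suc k) with L , 2^L≤ , <2^[1+L] ← floor-log₂ k with suc (suc k) ≟ 2 ^ suc L
... | yes 2+k≡ = suc L , ≤-reflexive (sym 2+k≡) ,
                 subst (_< 2 ^ suc (suc L)) (sym 2+k≡) (^-monoʳ-< 2 (s≤s (s≤s z≤n)) (n<1+n (suc L)))
... | no  2+k≢ = L , m≤n⇒m≤1+n 2^L≤ , ≤∧≢⇒< <2^[1+L] 2+k≢

2^a≤n<2^[1+b]⇒a≤b : ∀ {a b n} → 2 ^ a ≤ n → n < 2 ^ suc b → a ≤ b
2^a≤n<2^[1+b]⇒a≤b 2^a≤n n<2^[1+b] = ≮⇒≥ λ b<a → ≤⇒≯ (≤-trans (^-monoʳ-≤ 2 b<a) 2^a≤n) n<2^[1+b]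

LowerBound-intro : ∀ {j k c m} e → k ≤ 2 ^ e → e * (m * j) ≤ 2 * k * (j + 1) * c → LowerBound j k c m
LowerBound-intro {j} {k} {c} {m} e k≤2^e e*m*j≤ = begin
  k ^ (m * j)              ≤⟨ ^-monoˡ-≤ (m * j) k≤2^e ⟩
  (2 ^ e) ^ (m * j)        ≡⟨ ^-*-assoc 2 e (m * j) ⟩
  2 ^ (e * (m * j))        ≤⟨ ^-monoʳ-≤ 2 e*m*j≤ ⟩
  2 ^ (2 * k * (j + 1) * c) ∎
  where open ≤-Reasoning

UpperBound-intro : ∀ {j k c m} e → 2 ^ e ≤ k → 2 * k * (j + 1) * c ≤ e * (m * (j + 2)) → UpperBound j k c m
UpperBound-intro {j} {k} {c} {m} e 2^e≤k ≤e*m*j = begin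
  2 ^ (2 * k * (j + 1) * c) ≤⟨ ^-monoʳ-≤ 2 ≤e*m*j ⟩
  2 ^ (e * (m * (j + 2)))   ≡⟨ ^-*-assoc 2 e (m * (j + 2)) ⟨
  (2 ^ e) ^ (m * (j + 2))   ≤⟨ ^-monoˡ-≤ (m * (j + 2)) 2^e≤k ⟩
  k ^ (m * (j + 2))         ∎
  where open ≤-Reasoning

-- m = |F|, c = the count of a point of S, M = 2^k, t = the number of the R_p, P = 2^L,
-- r = the number of the R_p containing that point.
module FrequencyExponents {k L j M t P m c r : ℕ}
  (L≤k : L ≤ k) (k≤2P : k ≤ 2 * P) (2≤M : 2 ≤ M) (M≤t : M ≤ t) (8[j+1]≤L : 8 * (j + 1) ≤ L)
  (m≡ : m ≡ 1 + (M + t * (1 + P))) (2c≡ : 2 * c ≡ 2 + M + (2 * t + P * r)) (kr≡Lt : k * r ≡ L * t) where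

  open ≤-Reasoning

  k*2c≡ : k * (2 * c) ≡ k * (2 + M + 2 * t) + L * (P * t)
  k*2c≡ = begin-equality
    k * (2 * c)                           ≡⟨ cong (k *_) 2c≡ ⟩
    k * (2 + M + (2 * t + P * r))         ≡⟨ solve 5 (λ k M t P r → k :* (con 2 :+ M :+ (con 2 :* t :+ P :* r))
                                                    := k :* (con 2 :+ M :+ con 2 :* t) :+ P :* (k :* r))
                                                 refl k M t P r ⟩
    k * (2 + M + 2 * t) + P * (k * r)     ≡⟨ cong (λ x → k * (2 + M + 2 * t) + P * x) kr≡Lt ⟩
    k * (2 + M + 2 * t) + P * (L * t)     ≡⟨ cong (k * (2 + M + 2 * t) +_) (x∙yz≈y∙xz P L t) ⟩
    k * (2 + M + 2 * t) + L * (P * t)     ∎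

  2k[j+1]c≡ : 2 * k * (j + 1) * c ≡ (j + 1) * (k * (2 * c))
  2k[j+1]c≡ = solve 3 (λ k j c → con 2 :* k :* (j :+ con 1) :* c := (j :+ con 1) :* (k :* (con 2 :* c)))
                      refl k j c

  L*m≤k*2c : L * m ≤ k * (2 * c)
  L*m≤k*2c = begin
    L * m                                 ≡⟨ cong (L *_) m≡ ⟩
    L * (1 + (M + t * (1 + P)))           ≡⟨ solve 4 (λ L M t P → L :* (con 1 :+ (M :+ t :* (con 1 :+ P)))
                                                    := L :* (con 1 :+ M :+ t) :+ L :* (P :* t)) refl L M t P ⟩
    L * (1 + M + t) + L * (P * t)         ≤⟨ +-monoˡ-≤ (L * (P * t)) (*-mono-≤ L≤k 1+M+t≤) ⟩
    k * (2 + M + 2 * t) + L * (P * t)     ≡⟨ k*2c≡ ⟨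
    k * (2 * c)                           ∎
    where
    1+M+t≤ : 1 + M + t ≤ 2 + M + 2 * t
    1+M+t≤ = ≤-trans (m≤m+n (1 + M + t) (1 + t)) (≤-reflexive
               (solve 2 (λ M t → con 1 :+ M :+ t :+ (con 1 :+ t) := con 2 :+ M :+ con 2 :* t) refl M t))

  lower : suc L * (m * j) ≤ 2 * k * (j + 1) * c
  lower = begin
    suc L * (m * j)          ≡⟨ solve 3 (λ L m j → (con 1 :+ L) :* (m :* j) := (L :* j :+ j) :* m) refl L m j ⟩
    (L * j + j) * m          ≤⟨ *-monoˡ-≤ m (+-monoʳ-≤ (L * j) j≤L) ⟩
    (L * j + L) * m          ≡⟨ solve 3 (λ L m j → (L :* j :+ L) :* m := (j :+ con 1) :* (L :* m)) refl L m j ⟩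
    (j + 1) * (L * m)        ≤⟨ *-monoʳ-≤ (j + 1) L*m≤k*2c ⟩
    (j + 1) * (k * (2 * c))  ≡⟨ 2k[j+1]c≡ ⟨
    2 * k * (j + 1) * c      ∎
    where
    j≤L : j ≤ L
    j≤L = ≤-trans (≤-trans (m≤m+n j 1) (m≤n*m (j + 1) 8)) 8[j+1]≤L

  upper : 2 * k * (j + 1) * c ≤ L * (m * (j + 2))
  upper = begin
    2 * k * (j + 1) * c                                    ≡⟨ 2k[j+1]c≡ ⟩
    (j + 1) * (k * (2 * c))                                ≡⟨ cong ((j + 1) *_) k*2c≡ ⟩
    (j + 1) * (k * (2 + M + 2 * t) + L * (P * t))          ≡⟨ *-distribˡ-+ (j + 1) _ _ ⟩
    (j + 1) * (k * (2 + M + 2 * t)) + (j + 1) * (L * (P * t)) ≤⟨ +-monoˡ-≤ _ small ⟩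
    L * (P * t) + (j + 1) * (L * (P * t))                  ≡⟨ solve 3 (λ L j X → L :* X :+ (j :+ con 1) :* (L :* X)
                                                                         := L :* (X :* (j :+ con 2)))
                                                                       refl L j (P * t) ⟩
    L * (P * t * (j + 2))                                  ≤⟨ *-monoʳ-≤ L (*-monoˡ-≤ (j + 2) P*t≤m) ⟩
    L * (m * (j + 2))                                      ∎
    where
    2+M+2t≤4t : 2 + M + 2 * t ≤ 4 * t
    2+M+2t≤4t = begin
      2 + M + 2 * t ≤⟨ +-monoˡ-≤ (2 * t) (+-mono-≤ (≤-trans 2≤M M≤t) M≤t) ⟩
      t + t + 2 * t ≡⟨ solve 1 (λ t → t :+ t :+ con 2 :* t := con 4 :* t) refl t ⟩
      4 * t         ∎
    small : (j + 1) * (k * (2 + M + 2 * t)) ≤ L * (P * t)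
    small = begin
      (j + 1) * (k * (2 + M + 2 * t)) ≤⟨ *-monoʳ-≤ (j + 1) (*-mono-≤ k≤2P 2+M+2t≤4t) ⟩
      (j + 1) * (2 * P * (4 * t))     ≡⟨ solve 3 (λ j P t → (j :+ con 1) :* (con 2 :* P :* (con 4 :* t))
                                                  := con 8 :* (j :+ con 1) :* (P :* t)) refl j P t ⟩
      8 * (j + 1) * (P * t)           ≤⟨ *-monoˡ-≤ (P * t) 8[j+1]≤L ⟩
      L * (P * t)                     ∎
    P*t≤m : P * t ≤ m
    P*t≤m = begin
      P * t                     ≤⟨ m≤n+m (P * t) (1 + M + t) ⟩
      1 + M + t + P * t         ≡⟨ solve 3 (λ M t P → con 1 :+ M :+ t :+ P :* t
                                            := con 1 :+ (M :+ t :* (con 1 :+ P))) refl M t P ⟩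
      1 + (M + t * (1 + P))     ≡⟨ m≡ ⟨
      m                         ∎

module Witness (k L : ℕ) (L<k : L < k) where

  Rs : List (Subset k)
  Rs = concat (replicate (2 ^ k) (subsetsOfSize k L))

  N : ℕ
  N = length (subsetsOfSize k L)

  length-Rs : length Rs ≡ 2 ^ k * N
  length-Rs = length-concat-replicate (2 ^ k) (subsetsOfSize k L)

  2^k≤t : 2 ^ k ≤ length Rs
  2^k≤t = begin
    2 ^ k      ≡⟨ *-identityʳ (2 ^ k) ⟨
    2 ^ k * 1  ≤⟨ *-monoʳ-≤ (2 ^ k) (length-subsetsOfSize>0 (<⇒≤ L<k)) ⟩
    2 ^ k * N  ≡⟨ length-Rs ⟨
    length Rs  ∎
    where open ≤-Reasoning

  open UniformConstruction Rs (All.concat⁺ (All.replicate⁺ (2 ^ k) (∣∣-subsetsOfSize k L))) L<k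
                           (<-≤-trans (n<2^n k) 2^k≤t) public

  k*count≡L*t : (i : Fin k) → k * count i Rs ≡ L * t
  k*count≡L*t i = begin
    k * count i Rs                             ≡⟨ cong (k *_) (count-concat-replicate i (2 ^ k) _) ⟩
    k * (2 ^ k * count i (subsetsOfSize k L))  ≡⟨ x∙yz≈y∙xz k (2 ^ k) _ ⟩
    2 ^ k * (k * count i (subsetsOfSize k L))  ≡⟨ cong (2 ^ k *_) (subsetsOfSize-regular k L i) ⟩
    2 ^ k * (L * N)                            ≡⟨ x∙yz≈y∙xz (2 ^ k) L N ⟩
    L * (2 ^ k * N)                            ≡⟨ cong (L *_) length-Rs ⟨
    L * t                                      ∎
    where open ≡-Reasoning

  frequency-bounds : ∀ j → 2 ^ L ≤ k → k < 2 ^ suc L → 8 * (j + 1) ≤ L →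
    ∀ x → x ∈ₛ S → LowerBound j k (count x F) (length F) × UpperBound j k (count x F) (length F)
  frequency-bounds j 2^L≤k k<2^[1+L] 8[j+1]≤L x x∈S with i , refl ← ∈-++⊥⇒↑ˡ {k} {suc t} ⊤ x∈S =
    LowerBound-intro {j} {k} {count-x} {size-F} (suc L) (<⇒≤ k<2^[1+L]) lower ,
    UpperBound-intro {j} {k} {count-x} {size-F} L 2^L≤k upper
    where
    count-x size-F : ℕ
    count-x = count (i ↑ˡ suc t) F
    size-F  = length F
    2≤2^k : 2 ≤ 2 ^ k
    2≤2^k = ^-monoʳ-≤ 2 (≤-trans (s≤s z≤n) L<k)
    open FrequencyExponents {j = j} {m = size-F} {c = count-x} (<⇒≤ L<k) (<⇒≤ k<2^[1+L]) 2≤2^k 2^k≤t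
                            8[j+1]≤L length-F (2*count-F i) (k*count≡L*t i)

module OfSizeSuc (k : ℕ) where

  L : ℕ
  L = proj₁ (floor-log₂ k)

  2^L≤1+k : 2 ^ L ≤ suc k
  2^L≤1+k = proj₁ (proj₂ (floor-log₂ k))

  1+k<2^[1+L] : suc k < 2 ^ suc L
  1+k<2^[1+L] = proj₂ (proj₂ (floor-log₂ k))

  open Witness (suc k) L (<-≤-trans (n<2^n L) 2^L≤1+k) public

theorem1 : Σ ((k : ℕ) → 2 ≤ k → Construction k) λ C →
    (j : ℕ) → ∃ λ K → (k : ℕ) (hk : 2 ≤ k) → K ≤ k →
      (x : Fin (Construction.n (C k hk))) → x ∈ₛ Construction.S (C k hk) →
        LowerBound j k (count x (Construction.F (C k hk))) (length (Construction.F (C k hk)))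
        × UpperBound j k (count x (Construction.F (C k hk))) (length (Construction.F (C k hk)))
theorem1 = (λ { (suc k) _ → OfSizeSuc.construction k }) , λ j → 2 ^ (8 * (j + 1)) , λ where
  (suc k) _ K≤1+k → OfSizeSuc.frequency-bounds k j (OfSizeSuc.2^L≤1+k k) (OfSizeSuc.1+k<2^[1+L] k)
                      (2^a≤n<2^[1+b]⇒a≤b K≤1+k (OfSizeSuc.1+k<2^[1+L] k))
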